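{- A non-ambiguous binary tree on a rectangular Ferrers diagram $F$ with $r$ rows and $m$ columns has exactly $r+m-1$ dotted cells. If the non-ambiguous binary tree is complete, then $r=m$.
   Context: A non-ambiguous binary tree (NAB) is a filling of a rectangular $r\times m$ grid in which each cell is empty or dotted, such that (1) every row and every column contains a dotted cell; (2) except for the top-left cell, every dotted cell has either a dotted cell above it in its column or a dotted cell to its left in its row, but not both. Joining each dotted cell (other than the top-left one) to the nearest dotted cell above it in its column or to its left in its row gives a binary tree rooted at the top-left cell. The NAB is complete if every dotted cell has either both a dotted cell below it in its column and a dotted cell to its right in its row, or neither. -}

module Defs where

open import Data.Nat using (ℕ; zero; suc; _+_)
open import Data.Fin using (Fin; toℕ; _<_)
open import Data.Bool using (Bool; true; false; if_then_else_)
open import Data.List using (List; map; allFin)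
open import Data.Nat.ListAction using (sum)
open import Data.Product using (_×_; ∃-syntax)
open import Data.Sum using (_⊎_)
open import Relation.Nullary using (¬_)
open import Relation.Binary.PropositionalEquality using (_≡_)

-- A filling of an r × m grid: D i j ≡ true means cell (row i, column j) is dotted.
-- Rows are numbered top to bottom, columns left to right, starting at 0.
Filling : ℕ → ℕ → Set
Filling r m = Fin r → Fin m → Bool

module _ {r m : ℕ} (D : Filling r m) where

  Dotted : Fin r → Fin m → Set
  Dotted i j = D i j ≡ true

  DotAbove : Fin r → Fin m → Set
  DotAbove i j = ∃[ i' ] (i' < i × Dotted i' j)

  DotLeft : Fin r → Fin m → Set
  DotLeft i j = ∃[ j' ] (j' < j × Dotted i j')

  DotBelow : Fin r → Fin m → Set
  DotBelow i j = ∃[ i' ] (i < i' × Dotted i' j)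

  DotRight : Fin r → Fin m → Set
  DotRight i j = ∃[ j' ] (j < j' × Dotted i j')

  IsTopLeft : Fin r → Fin m → Set
  IsTopLeft i j = toℕ i ≡ 0 × toℕ j ≡ 0

  record IsNAB : Set where
    field
      rowsDotted : ∀ i → ∃[ j ] Dotted i j
      colsDotted : ∀ j → ∃[ i ] Dotted i j
      parent : ∀ i j → Dotted i j → ¬ IsTopLeft i j →
        (DotAbove i j × ¬ DotLeft i j) ⊎ (¬ DotAbove i j × DotLeft i j)

  IsComplete : Set
  IsComplete = ∀ i j → Dotted i j →
    (DotBelow i j × DotRight i j) ⊎ (¬ DotBelow i j × ¬ DotRight i j)

  dotCount : ℕ
  dotCount = sum (map (λ i → sum (map (λ j → if D i j then 1 else 0) (allFin m))) (allFin r))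

-- Each row and each column of a non-ambiguous binary tree has a unique first
-- dot, and the NAB condition says that every dot other than the root is first
-- in exactly one of its row and its column, while the root is first in both.
-- Counting first dots by rows and by columns therefore gives r + m = #dots + 1.
-- Completeness says that a dot is last in its row iff it is last in its
-- column, so counting last dots by rows and by columns gives r = m.
module Submission where

open import Defs
open import Data.Nat.Properties using (+-0-commutativeMonoid; +-identityʳ)
open import Algebra.Properties.CommutativeMonoid.Sum +-0-commutativeMonoid
  using (sum; sum-syntax; sum-cong-≗; ∑-distrib-+; ∑-comm; sum-replicate-zero)
open import Data.Bool using (Bool; true; false; if_then_else_; _∧_; _∨_; not)
open import Data.Bool.Properties using (∧-zeroʳ; ∨-zeroʳ; ¬-not)
open import Data.Fin using (Fin; zero; suc; _<_)
open import Data.Fin.Induction using (<-wellFounded)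
open import Data.List using (map; allFin; tabulate)
open import Data.List.Properties using (map-tabulate)
open import Data.Nat using (ℕ; zero; suc; _+_; _≤_; z≤n; s≤s)
import Data.Nat.ListAction as List
open import Data.Product using (_×_; _,_; ∃-syntax)
open import Data.Sum using (inj₁; inj₂)
open import Function using (_∘_; id)
open import Induction.WellFounded using (Acc; acc)
open import Relation.Nullary using (¬_; contraposition)
open import Relation.Binary.PropositionalEquality
  using (_≡_; refl; sym; trans; cong; cong₂; module ≡-Reasoning)

⟦_⟧ : Bool → ℕ
⟦ b ⟧ = if b then 1 else 0

⟦∨⟧-split : ∀ a b → ⟦ a ∨ b ⟧ ≡ ⟦ a ∧ not b ⟧ + ⟦ b ⟧
⟦∨⟧-split true  true  = refl
⟦∨⟧-split true  false = refl
⟦∨⟧-split false true  = refl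
⟦∨⟧-split false false = refl

∑-ones : ∀ {n} {f : Fin n → ℕ} → (∀ i → f i ≡ 1) → ∑[ i < n ] f i ≡ n
∑-ones {zero}  _    = refl
∑-ones {suc n} f≡1 = cong₂ _+_ (f≡1 zero) (∑-ones (f≡1 ∘ suc))

∑∑-distrib-+ : ∀ {r m} (f g : Fin r → Fin m → ℕ) →
  ∑[ i < r ] ∑[ j < m ] (f i j + g i j) ≡ ∑[ i < r ] ∑[ j < m ] f i j + ∑[ i < r ] ∑[ j < m ] g i j
∑∑-distrib-+ f g =
  trans (sum-cong-≗ (λ i → ∑-distrib-+ (f i) (g i))) (∑-distrib-+ (sum ∘ f) (sum ∘ g))

sum-tabulate : ∀ {n} (f : Fin n → ℕ) → List.sum (tabulate f) ≡ sum f
sum-tabulate {zero}  f = refl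
sum-tabulate {suc n} f = cong (f zero +_) (sum-tabulate (f ∘ suc))

sum-map-allFin : ∀ {n} (f : Fin n → ℕ) → List.sum (map f (allFin n)) ≡ sum f
sum-map-allFin f = trans (cong List.sum (map-tabulate id f)) (sum-tabulate f)

any : ∀ {n} → (Fin n → Bool) → Bool
any {zero}  g = false
any {suc n} g = g zero ∨ any (g ∘ suc)

anyBefore : ∀ {n} → (Fin n → Bool) → Fin n → Bool
anyBefore g zero    = false
anyBefore g (suc j) = g zero ∨ anyBefore (g ∘ suc) j

anyAfter : ∀ {n} → (Fin n → Bool) → Fin n → Bool
anyAfter g zero    = any (g ∘ suc)
anyAfter g (suc j) = anyAfter (g ∘ suc) j

isFirst : ∀ {n} → (Fin n → Bool) → Fin n → Bool
isFirst g j = g j ∧ not (anyBefore g j)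

isLast : ∀ {n} → (Fin n → Bool) → Fin n → Bool
isLast g j = g j ∧ not (anyAfter g j)

any⁺ : ∀ {n} (g : Fin n → Bool) {j} → g j ≡ true → any g ≡ true
any⁺ g {zero}  gj = cong (_∨ any (g ∘ suc)) gj
any⁺ g {suc j} gj = trans (cong (g zero ∨_) (any⁺ (g ∘ suc) gj)) (∨-zeroʳ (g zero))

any⁻ : ∀ {n} (g : Fin n → Bool) → any g ≡ true → ∃[ j ] g j ≡ true
any⁻ {suc n} g h with g zero in g₀
... | true  = zero , g₀
... | false with any⁻ (g ∘ suc) h
...   | j , gj = suc j , gj

anyBefore⁺ : ∀ {n} (g : Fin n → Bool) {j' j} → j' < j → g j' ≡ true → anyBefore g j ≡ true
anyBefore⁺ g {zero}   {suc j} _         gj' = cong (_∨ anyBefore (g ∘ suc) j) gj'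
anyBefore⁺ g {suc j'} {suc j} (s≤s lt) gj' =
  trans (cong (g zero ∨_) (anyBefore⁺ (g ∘ suc) lt gj')) (∨-zeroʳ (g zero))

anyBefore⁻ : ∀ {n} (g : Fin n → Bool) j → anyBefore g j ≡ true → ∃[ j' ] (j' < j × g j' ≡ true)
anyBefore⁻ g (suc j) h with g zero in g₀
... | true  = zero , s≤s z≤n , g₀
... | false with anyBefore⁻ (g ∘ suc) j h
...   | j' , lt , gj' = suc j' , s≤s lt , gj'

anyAfter⁺ : ∀ {n} (g : Fin n → Bool) {j j'} → j < j' → g j' ≡ true → anyAfter g j ≡ true
anyAfter⁺ g {zero}  {suc j'} _        gj' = any⁺ (g ∘ suc) gj'
anyAfter⁺ g {suc j} {suc j'} (s≤s lt) gj' = anyAfter⁺ (g ∘ suc) lt gj'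

anyAfter⁻ : ∀ {n} (g : Fin n → Bool) j → anyAfter g j ≡ true → ∃[ j' ] (j < j' × g j' ≡ true)
anyAfter⁻ g zero h with any⁻ (g ∘ suc) h
... | j' , gj' = suc j' , s≤s z≤n , gj'
anyAfter⁻ g (suc j) h with anyAfter⁻ (g ∘ suc) j h
... | j' , lt , gj' = suc j' , s≤s lt , gj'

∑-isFirst : ∀ {n} (g : Fin n → Bool) → ∑[ j < n ] ⟦ isFirst g j ⟧ ≡ ⟦ any g ⟧
∑-isFirst {zero}  g = refl
∑-isFirst {suc n} g with g zero
... | true  = cong suc (trans (sum-cong-≗ (λ j → cong ⟦_⟧ (∧-zeroʳ (g (suc j))))) (sum-replicate-zero n))
... | false = ∑-isFirst (g ∘ suc)

∑-isLast : ∀ {n} (g : Fin n → Bool) → ∑[ j < n ] ⟦ isLast g j ⟧ ≡ ⟦ any g ⟧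
∑-isLast {zero}  g = refl
∑-isLast {suc n} g =
  trans (cong (⟦ isLast g zero ⟧ +_) (∑-isLast (g ∘ suc))) (sym (⟦∨⟧-split (g zero) (any (g ∘ suc))))

∑-isFirst-nonempty : ∀ {n} (g : Fin n → Bool) → ∃[ j ] g j ≡ true → ∑[ j < n ] ⟦ isFirst g j ⟧ ≡ 1
∑-isFirst-nonempty g (_ , gj) = trans (∑-isFirst g) (cong ⟦_⟧ (any⁺ g gj))

∑-isLast-nonempty : ∀ {n} (g : Fin n → Bool) → ∃[ j ] g j ≡ true → ∑[ j < n ] ⟦ isLast g j ⟧ ≡ 1
∑-isLast-nonempty g (_ , gj) = trans (∑-isLast g) (cong ⟦_⟧ (any⁺ g gj))

column : ∀ {r m} → Filling r m → Fin m → Fin r → Bool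
column D j i = D i j

topLeft : ∀ {r m} → Fin r → Fin m → Bool
topLeft zero    zero    = true
topLeft zero    (suc _) = false
topLeft (suc _) _       = false

∑∑-topLeft : ∀ r m → ∑[ i < suc r ] ∑[ j < suc m ] ⟦ topLeft i j ⟧ ≡ 1
∑∑-topLeft r m = cong₂ (λ a b → suc a + b) (sum-replicate-zero m)
  (trans (sum-cong-≗ {r} (λ _ → sum-replicate-zero (suc m))) (sum-replicate-zero r))

dotCount≡∑∑ : ∀ {r m} (D : Filling r m) → dotCount D ≡ ∑[ i < r ] ∑[ j < m ] ⟦ D i j ⟧
dotCount≡∑∑ {r} {m} D =
  trans (sum-map-allFin (λ i → List.sum (map (λ j → ⟦ D i j ⟧) (allFin m))))
        (sum-cong-≗ {r} (λ i → sum-map-allFin (λ j → ⟦ D i j ⟧)))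

isLast-row≡isLast-column : ∀ {r m} {D : Filling r m} → IsComplete D → ∀ i j →
  isLast (D i) j ≡ isLast (column D j) i
isLast-row≡isLast-column {D = D} complete i j with D i j in dotted
... | false = refl
... | true with complete i j dotted
...   | inj₁ ((_ , i<i' , d') , (_ , j<j' , d''))
        rewrite anyAfter⁺ (D i) j<j' d''
              | anyAfter⁺ (column D j) i<i' d' = refl
...   | inj₂ (noBelow , noRight)
        rewrite ¬-not (contraposition (anyAfter⁻ (D i) j) noRight)
              | ¬-not (contraposition (anyAfter⁻ (column D j) i) noBelow) = refl

module _ {r m : ℕ} {D : Filling (suc r) (suc m)} (nab : IsNAB D) where
  open IsNAB nab

  root-dotted : Dotted D zero zero
  root-dotted with rowsDotted zero
  ... | j , d = walkLeft d (<-wellFounded j)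
    where
    walkLeft : ∀ {j} → Dotted D zero j → Acc _<_ j → Dotted D zero zero
    walkLeft {zero}  d _        = d
    walkLeft {suc j} d (acc rs) with parent zero (suc j) d (λ { (_ , ()) })
    ... | inj₁ ((_ , () , _) , _)
    ... | inj₂ (_ , j' , j'<j , d') = walkLeft d' (rs j'<j)

  isFirst-row+column-nonroot : ∀ i j → ¬ IsTopLeft D i j →
    ⟦ isFirst (D i) j ⟧ + ⟦ isFirst (column D j) i ⟧ ≡ ⟦ D i j ⟧
  isFirst-row+column-nonroot i j notRoot with D i j in dotted
  ... | false = refl
  ... | true with parent i j dotted notRoot
  ...   | inj₁ ((_ , i'<i , d') , noLeft)
          rewrite ¬-not (contraposition (anyBefore⁻ (D i) j) noLeft)
                | anyBefore⁺ (column D j) i'<i d' = refl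
  ...   | inj₂ (noAbove , (_ , j'<j , d'))
          rewrite anyBefore⁺ (D i) j'<j d'
                | ¬-not (contraposition (anyBefore⁻ (column D j) i) noAbove) = refl

  isFirst-row+column : ∀ i j → ⟦ isFirst (D i) j ⟧ + ⟦ isFirst (column D j) i ⟧ ≡ ⟦ D i j ⟧ + ⟦ topLeft i j ⟧
  isFirst-row+column zero    zero    rewrite root-dotted = refl
  isFirst-row+column zero    (suc j) = trans (isFirst-row+column-nonroot zero (suc j) (λ { (_ , ()) })) (sym (+-identityʳ _))
  isFirst-row+column (suc i) j       = trans (isFirst-row+column-nonroot (suc i) j (λ { (() , _) })) (sym (+-identityʳ _))

  dotCount+1≡r+m : dotCount D + 1 ≡ suc r + suc m
  dotCount+1≡r+m = begin
    dotCount D + 1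
      ≡⟨ cong₂ _+_ (dotCount≡∑∑ D) (sym (∑∑-topLeft r m)) ⟩
    ∑[ i < suc r ] ∑[ j < suc m ] ⟦ D i j ⟧ + ∑[ i < suc r ] ∑[ j < suc m ] ⟦ topLeft i j ⟧
      ≡⟨ sym (∑∑-distrib-+ (λ i j → ⟦ D i j ⟧) (λ i j → ⟦ topLeft i j ⟧)) ⟩
    ∑[ i < suc r ] ∑[ j < suc m ] (⟦ D i j ⟧ + ⟦ topLeft i j ⟧)
      ≡⟨ sum-cong-≗ (λ i → sum-cong-≗ (λ j → sym (isFirst-row+column i j))) ⟩
    ∑[ i < suc r ] ∑[ j < suc m ] (⟦ isFirst (D i) j ⟧ + ⟦ isFirst (column D j) i ⟧)
      ≡⟨ ∑∑-distrib-+ (λ i j → ⟦ isFirst (D i) j ⟧) (λ i j → ⟦ isFirst (column D j) i ⟧) ⟩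
    ∑[ i < suc r ] ∑[ j < suc m ] ⟦ isFirst (D i) j ⟧ + ∑[ i < suc r ] ∑[ j < suc m ] ⟦ isFirst (column D j) i ⟧
      ≡⟨ cong₂ _+_ (∑-ones (λ i → ∑-isFirst-nonempty (D i) (rowsDotted i)))
                   (trans (∑-comm (λ i j → ⟦ isFirst (column D j) i ⟧))
                          (∑-ones (λ j → ∑-isFirst-nonempty (column D j) (colsDotted j)))) ⟩
    suc r + suc m
      ∎
    where open ≡-Reasoning

  complete⇒r≡m : IsComplete D → suc r ≡ suc m
  complete⇒r≡m complete = begin
    suc r
      ≡⟨ sym (∑-ones (λ i → ∑-isLast-nonempty (D i) (rowsDotted i))) ⟩
    ∑[ i < suc r ] ∑[ j < suc m ] ⟦ isLast (D i) j ⟧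
      ≡⟨ sum-cong-≗ (λ i → sum-cong-≗ (λ j → cong ⟦_⟧ (isLast-row≡isLast-column complete i j))) ⟩
    ∑[ i < suc r ] ∑[ j < suc m ] ⟦ isLast (column D j) i ⟧
      ≡⟨ ∑-comm (λ i j → ⟦ isLast (column D j) i ⟧) ⟩
    ∑[ j < suc m ] ∑[ i < suc r ] ⟦ isLast (column D j) i ⟧
      ≡⟨ ∑-ones (λ j → ∑-isLast-nonempty (column D j) (colsDotted j)) ⟩
    suc m
      ∎
    where open ≡-Reasoning

lemma4p5 : (r m : ℕ) → 1 ≤ r → 1 ≤ m → (D : Filling r m) → IsNAB D →
    (dotCount D + 1 ≡ r + m) × (IsComplete D → r ≡ m)
lemma4p5 (suc r) (suc m) (s≤s z≤n) (s≤s z≤n) D nab = dotCount+1≡r+m nab , complete⇒r≡m nab
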